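{- Let $Q$ be a quadratic form on $\mathbb{F}_2^n$ with bilinear form $B(u,v)=Q(u+v)+Q(u)+Q(v)$, and suppose that the only $r\in\mathrm{rad}(\mathbb{F}_2^n)$ with $Q(r)=0$ is $r=0$. Let $H\subseteq\mathbb{F}_2^n$ be a subspace of codimension $1$, let $S=\{v\in\mathbb{F}_2^n: Q(v)=0\}\setminus H$, and suppose $S$ generates $\mathbb{F}_2^n$. Then for every subset $T\subseteq S$, \[|T^{\perp}\cap T|\le|S|-|T|.\]
   Context: $\mathrm{rad}(\mathbb{F}_2^n)=\{r: B(r,w)=0\text{ for all }w\in\mathbb{F}_2^n\}$. For $T\subseteq\mathbb{F}_2^n$, $T^{\perp}=\{v: B(v,t)=0\text{ for all }t\in T\}$. A quadratic form on $\mathbb{F}_2^n$ is a map $Q(u)=\sum_{i\le j}a_{ij}u_iu_j$. -}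

module Defs where

open import Data.Bool using (Bool; true; false; _xor_; _∧_; _∨_; not; if_then_else_)
open import Data.Nat using (ℕ; zero; suc; _≤ᵇ_)
open import Data.Fin using (Fin; toℕ)
open import Data.Vec using (Vec; []; _∷_; zipWith; replicate; lookup)
open import Data.List using (List; []; _∷_; _++_; map; concatMap; allFin; foldr)
open import Data.List.Relation.Unary.All using (All)
open import Data.Product using (Σ; _×_; ∃)
open import Relation.Binary.PropositionalEquality using (_≡_)

-- Vectors of 𝔽₂ⁿ, with 𝔽₂ = Bool (addition = xor, multiplication = ∧).
V : ℕ → Set
V n = Vec Bool n

_⊕_ : ∀ {n} → V n → V n → V n
u ⊕ v = zipWith _xor_ u v

𝟎 : ∀ {n} → V n
𝟎 {n} = replicate n false

allVecs : (n : ℕ) → List (V n)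
allVecs zero = [] ∷ []
allVecs (suc n) = map (false ∷_) (allVecs n) ++ map (true ∷_) (allVecs n)

xorSum : List Bool → Bool
xorSum = foldr _xor_ false

vsum : ∀ {n} → List (V n) → V n
vsum = foldr _⊕_ 𝟎

-- Coefficients a_{ij}; only those with i ≤ j are used.
Coeffs : ℕ → Set
Coeffs n = Fin n → Fin n → Bool

Q : ∀ {n} → Coeffs n → V n → Bool
Q {n} a u = xorSum (concatMap (λ i → map (λ j →
  if toℕ i ≤ᵇ toℕ j then a i j ∧ (lookup u i ∧ lookup u j) else false) (allFin n)) (allFin n))

B : ∀ {n} → Coeffs n → V n → V n → Bool
B a u v = Q a (u ⊕ v) xor (Q a u xor Q a v)

Subset : ℕ → Set
Subset n = V n → Bool

card : ∀ {n} → Subset n → ℕ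
card {n} P = foldr (λ v acc → if P v then suc acc else acc) 0 (allVecs n)

_⊆_ : ∀ {n} → Subset n → Subset n → Set
_⊆_ {n} P R = (v : V n) → P v ≡ true → R v ≡ true

IsSubspace : ∀ {n} → Subset n → Set
IsSubspace {n} H = (H 𝟎 ≡ true) × ((u v : V n) → H u ≡ true → H v ≡ true → H (u ⊕ v) ≡ true)

combo : ∀ {n k} → Vec Bool k → Vec (V n) k → V n
combo [] [] = 𝟎
combo (c ∷ cs) (b ∷ bs) = (if c then b else 𝟎) ⊕ combo cs bs

LinIndep : ∀ {n k} → Vec (V n) k → Set
LinIndep {n} {k} b = (c : Vec Bool k) → combo c b ≡ 𝟎 → c ≡ replicate k false

HasDim : ∀ {n} → Subset n → ℕ → Set
HasDim {n} H k = IsSubspace H × Σ (Vec (V n) k) (λ b →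
  Data.Vec.Relation.Unary.All.All (λ x → H x ≡ true) b × LinIndep b ×
  ((v : V n) → H v ≡ true → ∃ (λ (c : Vec Bool k) → combo c b ≡ v)))
  where import Data.Vec.Relation.Unary.All

Codim1 : ∀ {n} → Subset n → Set
Codim1 {n} H = Σ ℕ (λ m → (suc m ≡ n) × HasDim H m)

RadAnisotropic : ∀ {n} → Coeffs n → Set
RadAnisotropic {n} a = (r : V n) → ((w : V n) → B a r w ≡ false) → Q a r ≡ false → r ≡ 𝟎

Sset : ∀ {n} → Coeffs n → Subset n → Subset n
Sset a H v = not (Q a v) ∧ not (H v)

Generates : ∀ {n} → Subset n → Set
Generates {n} S = (v : V n) → ∃ (λ (ls : List (V n)) → All (λ s → S s ≡ true) ls × vsum ls ≡ v)

perp : ∀ {n} → Coeffs n → Subset n → Subset n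
perp {n} a T v = foldr (λ t acc → (not (T t) ∨ not (B a v t)) ∧ acc) true (allVecs n)

_∩_ : ∀ {n} → Subset n → Subset n → Subset n
(P ∩ R) v = P v ∧ R v

module Submission where

-- Write S = {Q = 0} ∖ H and U = T^⊥ ∩ T.  Since T ⊆ S, |S| = |S ∖ T| + |T|, so it suffices
-- to inject U into S ∖ T.  Every element of U is a singular vector outside H, and U is
-- totally isotropic.  For u ∈ U choose, by a fixed search order,
--   * a partner s ∈ S with B(u,s) = 1: u ≠ 0 is singular, so by the hypothesis on the radical
--     it is not in the radical, and as S generates 𝔽₂ⁿ some element of S pairs with it;
--   * x(u) = the first element of S in the coset s + U^⊥, so x(u) depends only on B(s,·)|_U;
--   * m(u) = the first element of U with B(x(u),m(u)) = 1 (u itself qualifies);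
-- and put g(u) = x(u) + u + m(u).  Expanding Q shows g(u) is singular; u, m(u) ∉ H and H has
-- codimension one, so u + m(u) ∈ H and g(u) ∉ H; and B(g(u),·)|_U = B(x(u),·)|_U, so
-- B(u,g(u)) = 1 and g(u) ∉ T.  The same identity shows that g(u) determines the class of s,
-- hence x(u), hence m(u), hence u: g is injective.

open import Defs
open import Algebra.Bundles using (CommutativeRing)
open import Data.Bool using (Bool; true; false; _xor_; _∧_; _∨_; not; if_then_else_; _≟_)
open import Data.Bool.Properties
  using (xor-comm; xor-assoc; xor-same; xor-identityˡ; xor-identityʳ; ∧-distribˡ-xor; ∧-distribʳ-xor;
         xor-∧-commutativeRing)
open import Algebra.Properties.CommutativeSemigroup
  (CommutativeRing.+-commutativeSemigroup xor-∧-commutativeRing) using () renaming (interchange to xor-interchange)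
open import Data.Empty using (⊥; ⊥-elim)
open import Relation.Nullary using (¬_)
open import Data.Fin using (Fin; toℕ)
open import Data.List using (List; []; _∷_; _++_; map; concatMap; foldr; length; allFin; filter)
open import Data.List.Properties using (length-map; length-++; length-++-sucʳ; map-cong)
open import Data.List.Membership.Propositional using (_∈_)
open import Data.List.Membership.Propositional.Properties
  using (∈-∃++; ∈-++⁻; ∈-++⁺ˡ; ∈-++⁺ʳ; ∈-map⁺; ∈-map⁻; ∈-filter⁺; ∈-filter⁻)
open import Data.List.Relation.Unary.Any using (here; there)
open import Data.List.Relation.Unary.All using (All; []; _∷_)
import Data.List.Relation.Unary.All as All
open import Data.List.Relation.Unary.All.Properties using () renaming (map⁺ to All-map⁺)
open import Data.List.Relation.Unary.AllPairs using ([]; _∷_)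
open import Data.List.Relation.Unary.Unique.Propositional using (Unique)
import Data.List.Relation.Unary.Unique.Propositional.Properties as Unique
open import Data.Nat using (ℕ; zero; suc; _+_; _^_; _≤_; _∸_; _≤ᵇ_; z≤n; s≤s)
open import Data.Nat.Properties
  using (+-identityʳ; +-suc; +-monoˡ-≤; m+n≤o⇒m≤o∸n; <⇒≱; ^-monoʳ-<; n<1+n; module ≤-Reasoning)
open import Data.Product using (_×_; _,_; proj₁; proj₂)
open import Data.Sum using (_⊎_; inj₁; inj₂)
open import Data.Vec using (Vec; []; _∷_; lookup)
open import Data.Vec.Relation.Unary.All using ([]; _∷_) renaming (All to VecAll)
open import Data.Vec.Properties using (∷-injectiveʳ; zipWith-comm; zipWith-assoc; zipWith-identityˡ; zipWith-identityʳ; lookup-zipWith)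
open import Relation.Binary.PropositionalEquality

true≢false : ∀ {b : Bool} → b ≡ true → b ≡ false → ⊥
true≢false refl ()

∧-true⁻ : ∀ {p q : Bool} → p ∧ q ≡ true → (p ≡ true) × (q ≡ true)
∧-true⁻ {true} {true} _ = refl , refl

not-true⁻ : ∀ {p : Bool} → not p ≡ true → p ≡ false
not-true⁻ {false} _ = refl

xor-false⁻ : ∀ {p q : Bool} → p xor q ≡ false → p ≡ q
xor-false⁻ {false} {false} _ = refl
xor-false⁻ {true} {true} _ = refl

⊕-comm : ∀ {n} (u v : V n) → u ⊕ v ≡ v ⊕ u
⊕-comm = zipWith-comm xor-comm

⊕-assoc : ∀ {n} (u v w : V n) → (u ⊕ v) ⊕ w ≡ u ⊕ (v ⊕ w)
⊕-assoc = zipWith-assoc xor-assoc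

⊕-identityˡ : ∀ {n} (u : V n) → 𝟎 ⊕ u ≡ u
⊕-identityˡ = zipWith-identityˡ xor-identityˡ

⊕-identityʳ : ∀ {n} (u : V n) → u ⊕ 𝟎 ≡ u
⊕-identityʳ = zipWith-identityʳ xor-identityʳ

⊕-self : ∀ {n} (u : V n) → u ⊕ u ≡ 𝟎
⊕-self [] = refl
⊕-self (x ∷ u) = cong₂ _∷_ (xor-same x) (⊕-self u)

⊕-interchange : ∀ {n} (u v w z : V n) → (u ⊕ v) ⊕ (w ⊕ z) ≡ (u ⊕ w) ⊕ (v ⊕ z)
⊕-interchange [] [] [] [] = refl
⊕-interchange (x ∷ u) (y ∷ v) (z ∷ w) (t ∷ s) = cong₂ _∷_ (xor-interchange x y z t) (⊕-interchange u v w s)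

⊕-involutive : ∀ {n} (x y : V n) → x ⊕ (x ⊕ y) ≡ y
⊕-involutive x y = begin
  x ⊕ (x ⊕ y)  ≡⟨ sym (⊕-assoc x x y) ⟩
  (x ⊕ x) ⊕ y  ≡⟨ cong (_⊕ y) (⊕-self x) ⟩
  𝟎 ⊕ y        ≡⟨ ⊕-identityˡ y ⟩
  y            ∎
  where open ≡-Reasoning

⊕-cancelˡ : ∀ {n} (x : V n) {y z : V n} → x ⊕ y ≡ x ⊕ z → y ≡ z
⊕-cancelˡ x {y} {z} e = trans (sym (⊕-involutive x y)) (trans (cong (x ⊕_) e) (⊕-involutive x z))

⊕-cancelʳ : ∀ {n} (x : V n) {y z : V n} → y ⊕ x ≡ z ⊕ x → y ≡ z
⊕-cancelʳ x {y} {z} e = ⊕-cancelˡ x (trans (⊕-comm x y) (trans e (⊕-comm z x)))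

⊕≡𝟎⇒≡ : ∀ {n} (x y : V n) → x ⊕ y ≡ 𝟎 → x ≡ y
⊕≡𝟎⇒≡ x y e = ⊕-cancelˡ x (trans (⊕-self x) (sym e))

lookup-⊕ : ∀ {n} (u v : V n) (i : Fin n) → lookup (u ⊕ v) i ≡ lookup u i xor lookup v i
lookup-⊕ u v i = lookup-zipWith _xor_ i u v

ΣΣ : {I J : Set} → (I → J → Bool) → List I → List J → Bool
ΣΣ F is js = xorSum (concatMap (λ i → map (F i) js) is)

xorSum-++ : (xs ys : List Bool) → xorSum (xs ++ ys) ≡ xorSum xs xor xorSum ys
xorSum-++ [] ys = refl
xorSum-++ (x ∷ xs) ys = trans (cong (x xor_) (xorSum-++ xs ys)) (sym (xor-assoc x _ _))

xorSum-map-xor : {J : Set} (f g : J → Bool) (js : List J) →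
  xorSum (map f js) xor xorSum (map g js) ≡ xorSum (map (λ j → f j xor g j) js)
xorSum-map-xor f g [] = refl
xorSum-map-xor f g (j ∷ js) =
  trans (xor-interchange (f j) _ (g j) _) (cong ((f j xor g j) xor_) (xorSum-map-xor f g js))

ΣΣ-xor : {I J : Set} (F G : I → J → Bool) (is : List I) (js : List J) →
  ΣΣ F is js xor ΣΣ G is js ≡ ΣΣ (λ i j → F i j xor G i j) is js
ΣΣ-xor F G [] js = refl
ΣΣ-xor F G (i ∷ is) js = begin
  xorSum (map (F i) js ++ rest F) xor xorSum (map (G i) js ++ rest G)
    ≡⟨ cong₂ _xor_ (xorSum-++ (map (F i) js) _) (xorSum-++ (map (G i) js) _) ⟩
  (xorSum (map (F i) js) xor ΣΣ F is js) xor (xorSum (map (G i) js) xor ΣΣ G is js)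
    ≡⟨ xor-interchange (xorSum (map (F i) js)) _ _ _ ⟩
  (xorSum (map (F i) js) xor xorSum (map (G i) js)) xor (ΣΣ F is js xor ΣΣ G is js)
    ≡⟨ cong₂ _xor_ (xorSum-map-xor (F i) (G i) js) (ΣΣ-xor F G is js) ⟩
  xorSum (map (FG i) js) xor ΣΣ FG is js
    ≡⟨ sym (xorSum-++ (map (FG i) js) _) ⟩
  ΣΣ FG (i ∷ is) js ∎
  where
  open ≡-Reasoning
  FG = λ i j → F i j xor G i j
  rest = λ K → concatMap (λ i → map (K i) js) is

ΣΣ-cong : {I J : Set} {F G : I → J → Bool} → (∀ i j → F i j ≡ G i j) →
  (is : List I) (js : List J) → ΣΣ F is js ≡ ΣΣ G is js
ΣΣ-cong F≗G [] js = refl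
ΣΣ-cong {F = F} {G} F≗G (i ∷ is) js = begin
  xorSum (map (F i) js ++ concatMap (λ i → map (F i) js) is)
    ≡⟨ xorSum-++ (map (F i) js) _ ⟩
  xorSum (map (F i) js) xor ΣΣ F is js
    ≡⟨ cong₂ (λ l r → xorSum l xor r) (map-cong (F≗G i) js) (ΣΣ-cong F≗G is js) ⟩
  xorSum (map (G i) js) xor ΣΣ G is js
    ≡⟨ sym (xorSum-++ (map (G i) js) _) ⟩
  ΣΣ G (i ∷ is) js ∎
  where open ≡-Reasoning

monomial : ∀ {n} → Coeffs n → V n → Fin n → Fin n → Bool
monomial a u i j = if toℕ i ≤ᵇ toℕ j then a i j ∧ (lookup u i ∧ lookup u j) else false

polar : ∀ {n} → Coeffs n → V n → V n → Fin n → Fin n → Bool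
polar a u v i j =
  if toℕ i ≤ᵇ toℕ j then a i j ∧ (lookup u i ∧ lookup v j xor lookup v i ∧ lookup u j) else false

product-polarisation : ∀ p p' q q' → (p xor p') ∧ (q xor q') xor (p ∧ q xor p' ∧ q') ≡ p ∧ q' xor p' ∧ q
product-polarisation false false false false = refl
product-polarisation false false false true  = refl
product-polarisation false false true  false = refl
product-polarisation false false true  true  = refl
product-polarisation false true  false false = refl
product-polarisation false true  false true  = refl
product-polarisation false true  true  false = refl
product-polarisation false true  true  true  = refl
product-polarisation true  false false false = refl
product-polarisation true  false false true  = refl
product-polarisation true  false true  false = refl
product-polarisation true  false true  true  = refl
product-polarisation true  true  false false = refl
product-polarisation true  true  false true  = refl
product-polarisation true  true  true  false = refl
product-polarisation true  true  true  true  = refl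

monomial-polar : ∀ {n} (a : Coeffs n) (u v : V n) i j →
  monomial a (u ⊕ v) i j xor (monomial a u i j xor monomial a v i j) ≡ polar a u v i j
monomial-polar a u v i j with toℕ i ≤ᵇ toℕ j
... | false = refl
... | true rewrite lookup-⊕ u v i | lookup-⊕ u v j with a i j
...   | false = refl
...   | true = product-polarisation (lookup u i) (lookup v i) (lookup u j) (lookup v j)

B-polar : ∀ {n} (a : Coeffs n) (u v : V n) → B a u v ≡ ΣΣ (polar a u v) (allFin n) (allFin n)
B-polar {n} a u v = begin
  Q a (u ⊕ v) xor (Q a u xor Q a v)
    ≡⟨ cong (Q a (u ⊕ v) xor_) (ΣΣ-xor (monomial a u) (monomial a v) I I) ⟩
  Q a (u ⊕ v) xor ΣΣ (λ i j → monomial a u i j xor monomial a v i j) I I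
    ≡⟨ ΣΣ-xor (monomial a (u ⊕ v)) _ I I ⟩
  ΣΣ (λ i j → monomial a (u ⊕ v) i j xor (monomial a u i j xor monomial a v i j)) I I
    ≡⟨ ΣΣ-cong (monomial-polar a u v) I I ⟩
  ΣΣ (polar a u v) I I ∎
  where
  open ≡-Reasoning
  I = allFin n

polar-term-linear : ∀ c p q x y x' y' →
  c ∧ (p ∧ (y xor y') xor (x xor x') ∧ q) ≡ c ∧ (p ∧ y xor x ∧ q) xor c ∧ (p ∧ y' xor x' ∧ q)
polar-term-linear c p q x y x' y' = begin
  c ∧ (p ∧ (y xor y') xor (x xor x') ∧ q)
    ≡⟨ cong (c ∧_) (cong₂ _xor_ (∧-distribˡ-xor p y y') (∧-distribʳ-xor q x x')) ⟩
  c ∧ ((p ∧ y xor p ∧ y') xor (x ∧ q xor x' ∧ q))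
    ≡⟨ cong (c ∧_) (xor-interchange (p ∧ y) (p ∧ y') (x ∧ q) (x' ∧ q)) ⟩
  c ∧ ((p ∧ y xor x ∧ q) xor (p ∧ y' xor x' ∧ q))
    ≡⟨ ∧-distribˡ-xor c _ _ ⟩
  c ∧ (p ∧ y xor x ∧ q) xor c ∧ (p ∧ y' xor x' ∧ q) ∎
  where open ≡-Reasoning

polar-linear : ∀ {n} (a : Coeffs n) (u v w : V n) i j →
  polar a u (v ⊕ w) i j ≡ polar a u v i j xor polar a u w i j
polar-linear a u v w i j with toℕ i ≤ᵇ toℕ j
... | false = refl
... | true rewrite lookup-⊕ v w i | lookup-⊕ v w j =
  polar-term-linear (a i j) (lookup u i) (lookup u j) (lookup v i) (lookup v j) (lookup w i) (lookup w j)

B-linearʳ : ∀ {n} (a : Coeffs n) (u v w : V n) → B a u (v ⊕ w) ≡ B a u v xor B a u w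
B-linearʳ {n} a u v w = begin
  B a u (v ⊕ w)                                             ≡⟨ B-polar a u (v ⊕ w) ⟩
  ΣΣ (polar a u (v ⊕ w)) I I                                ≡⟨ ΣΣ-cong (polar-linear a u v w) I I ⟩
  ΣΣ (λ i j → polar a u v i j xor polar a u w i j) I I      ≡⟨ sym (ΣΣ-xor (polar a u v) (polar a u w) I I) ⟩
  ΣΣ (polar a u v) I I xor ΣΣ (polar a u w) I I             ≡⟨ sym (cong₂ _xor_ (B-polar a u v) (B-polar a u w)) ⟩
  B a u v xor B a u w                                       ∎
  where
  open ≡-Reasoning
  I = allFin n

B-sym : ∀ {n} (a : Coeffs n) (u v : V n) → B a u v ≡ B a v u
B-sym a u v = cong₂ (λ w q → Q a w xor q) (⊕-comm u v) (xor-comm (Q a u) (Q a v))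

B-linearˡ : ∀ {n} (a : Coeffs n) (u v w : V n) → B a (u ⊕ v) w ≡ B a u w xor B a v w
B-linearˡ a u v w = begin
  B a (u ⊕ v) w        ≡⟨ B-sym a (u ⊕ v) w ⟩
  B a w (u ⊕ v)        ≡⟨ B-linearʳ a w u v ⟩
  B a w u xor B a w v  ≡⟨ cong₂ _xor_ (B-sym a w u) (B-sym a w v) ⟩
  B a u w xor B a v w  ∎
  where open ≡-Reasoning

B-zeroˡ : ∀ {n} (a : Coeffs n) (u : V n) → B a 𝟎 u ≡ false
B-zeroˡ a u = begin
  B a 𝟎 u              ≡⟨ cong (λ z → B a z u) (sym (⊕-identityˡ 𝟎)) ⟩
  B a (𝟎 ⊕ 𝟎) u        ≡⟨ B-linearˡ a 𝟎 𝟎 u ⟩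
  B a 𝟎 u xor B a 𝟎 u  ≡⟨ xor-same (B a 𝟎 u) ⟩
  false                ∎
  where open ≡-Reasoning

Q-⊕ : ∀ {n} (a : Coeffs n) (u v : V n) → Q a (u ⊕ v) ≡ B a u v xor (Q a u xor Q a v)
Q-⊕ a u v = begin
  Q a (u ⊕ v)                                                ≡⟨ sym (xor-identityʳ _) ⟩
  Q a (u ⊕ v) xor false                                      ≡⟨ cong (Q a (u ⊕ v) xor_) (sym (xor-same (Q a u xor Q a v))) ⟩
  Q a (u ⊕ v) xor ((Q a u xor Q a v) xor (Q a u xor Q a v))  ≡⟨ sym (xor-assoc (Q a (u ⊕ v)) _ _) ⟩
  B a u v xor (Q a u xor Q a v)                              ∎
  where open ≡-Reasoning

B-vsum : ∀ {n} (a : Coeffs n) (v : V n) (ls : List (V n)) →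
  All (λ s → B a v s ≡ false) ls → B a v (vsum ls) ≡ false
B-vsum a v [] [] = trans (B-sym a v 𝟎) (B-zeroˡ a v)
B-vsum a v (s ∷ ls) (v⊥s ∷ v⊥ls) = trans (B-linearʳ a v s (vsum ls)) (cong₂ _xor_ v⊥s (B-vsum a v ls v⊥ls))

orthogonal-to-generators : ∀ {n} (a : Coeffs n) (G : Subset n) → RadAnisotropic a → Generates G →
  ∀ v → Q a v ≡ false → (∀ s → G s ≡ true → B a v s ≡ false) → v ≡ 𝟎
orthogonal-to-generators a G anis gen v v-singular v⊥G = anis v in-radical v-singular
  where
  in-radical : ∀ w → B a v w ≡ false
  in-radical w with gen w
  ... | ls , ls⊆G , refl = B-vsum a v ls (All.map (λ {s} → v⊥G s) ls⊆G)

module _ {A : Set} where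

  count : (A → Bool) → List A → ℕ
  count p = foldr (λ x acc → if p x then suc acc else acc) 0

  select : (A → Bool) → List A → List A
  select p = filter (λ x → p x ≟ true)

  count≡length-select : (p : A → Bool) (xs : List A) → count p xs ≡ length (select p xs)
  count≡length-select p [] = refl
  count≡length-select p (x ∷ xs) with p x
  ... | true = cong suc (count≡length-select p xs)
  ... | false = count≡length-select p xs

  count-true : (xs : List A) → count (λ _ → true) xs ≡ length xs
  count-true [] = refl
  count-true (x ∷ xs) = cong suc (count-true xs)

  count-split : (p q : A → Bool) (xs : List A) → (∀ x → q x ≡ true → p x ≡ true) →
    count (λ x → p x ∧ not (q x)) xs + count q xs ≡ count p xs
  count-split p q [] q⇒p = refl
  count-split p q (x ∷ xs) q⇒p with q x in qx | p x in px
  ... | true  | true  = trans (+-suc _ _) (cong suc (count-split p q xs q⇒p))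
  ... | true  | false = ⊥-elim (true≢false (q⇒p x qx) px)
  ... | false | true  = cong suc (count-split p q xs q⇒p)
  ... | false | false = count-split p q xs q⇒p

  unique-⊆-length : {xs ys : List A} → Unique xs → (∀ {x} → x ∈ xs → x ∈ ys) → length xs ≤ length ys
  unique-⊆-length {[]} _ _ = z≤n
  unique-⊆-length {x ∷ xs} (x∉xs ∷ xs-unique) xs⊆ys with ∈-∃++ (xs⊆ys (here refl))
  ... | ys₁ , ys₂ , refl = begin
    suc (length xs)            ≤⟨ s≤s (unique-⊆-length xs-unique xs⊆ys₁ys₂) ⟩
    suc (length (ys₁ ++ ys₂))  ≡⟨ sym (length-++-sucʳ ys₁ x ys₂) ⟩
    length (ys₁ ++ x ∷ ys₂)    ∎
    where
    open ≤-Reasoning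
    xs⊆ys₁ys₂ : ∀ {y} → y ∈ xs → y ∈ ys₁ ++ ys₂
    xs⊆ys₁ys₂ y∈xs with ∈-++⁻ ys₁ (xs⊆ys (there y∈xs))
    ... | inj₁ y∈ys₁ = ∈-++⁺ˡ y∈ys₁
    ... | inj₂ (here refl) = ⊥-elim (All.lookup x∉xs y∈xs refl)
    ... | inj₂ (there y∈ys₂) = ∈-++⁺ʳ ys₁ y∈ys₂

  map-unique : {C : Set} (g : A → C) {xs : List A} →
    (∀ {x y} → x ∈ xs → y ∈ xs → g x ≡ g y → x ≡ y) → Unique xs → Unique (map g xs)
  map-unique g {[]} injective [] = []
  map-unique g {x ∷ xs} injective (x∉xs ∷ xs-unique) =
    All-map⁺ (All.tabulate (λ y∈xs gx≡gy → All.lookup x∉xs y∈xs (injective (here refl) (there y∈xs) gx≡gy)))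
    ∷ map-unique g (λ x∈xs y∈xs → injective (there x∈xs) (there y∈xs)) xs-unique

allVecs-complete : ∀ {n} (v : V n) → v ∈ allVecs n
allVecs-complete [] = here refl
allVecs-complete {suc n} (false ∷ v) = ∈-++⁺ˡ (∈-map⁺ (false ∷_) (allVecs-complete v))
allVecs-complete {suc n} (true ∷ v) = ∈-++⁺ʳ (map (false ∷_) (allVecs n)) (∈-map⁺ (true ∷_) (allVecs-complete v))

allVecs-unique : ∀ n → Unique (allVecs n)
allVecs-unique zero = [] ∷ []
allVecs-unique (suc n) =
  Unique.++⁺ (Unique.map⁺ ∷-injectiveʳ (allVecs-unique n)) (Unique.map⁺ ∷-injectiveʳ (allVecs-unique n)) disjoint
  where
  disjoint : ∀ {v} → ¬ (v ∈ map (false ∷_) (allVecs n) × v ∈ map (true ∷_) (allVecs n))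
  disjoint (v∈₀ , v∈₁) with ∈-map⁻ (false ∷_) v∈₀ | ∈-map⁻ (true ∷_) v∈₁
  ... | _ , _ , refl | _ , _ , ()

allVecs-length : ∀ n → length (allVecs n) ≡ 2 ^ n
allVecs-length zero = refl
allVecs-length (suc n) = begin
  length (map (false ∷_) (allVecs n) ++ map (true ∷_) (allVecs n))
    ≡⟨ length-++ (map (false ∷_) (allVecs n)) ⟩
  length (map (false ∷_) (allVecs n)) + length (map (true ∷_) (allVecs n))
    ≡⟨ cong₂ _+_ (length-map _ (allVecs n)) (length-map _ (allVecs n)) ⟩
  length (allVecs n) + length (allVecs n)
    ≡⟨ cong₂ _+_ (allVecs-length n) (trans (allVecs-length n) (sym (+-identityʳ (2 ^ n)))) ⟩
  2 ^ suc n ∎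
  where open ≡-Reasoning

card-injection : ∀ {k n} (P : Subset k) (R : Subset n) (g : V k → V n) →
  (∀ v → P v ≡ true → R (g v) ≡ true) →
  (∀ u v → P u ≡ true → P v ≡ true → g u ≡ g v → u ≡ v) → card P ≤ card R
card-injection {k} {n} P R g maps-into injective = begin
  card P                           ≡⟨ count≡length-select P (allVecs k) ⟩
  length (select P (allVecs k))    ≡⟨ sym (length-map g (select P (allVecs k))) ⟩
  length (map g (select P (allVecs k)))
    ≤⟨ unique-⊆-length (map-unique g injective-on-P (Unique.filter⁺ (λ x → P x ≟ true) (allVecs-unique k))) image⊆R ⟩
  length (select R (allVecs n))    ≡⟨ sym (count≡length-select R (allVecs n)) ⟩
  card R                           ∎
  where
  open ≤-Reasoning
  in-P : ∀ {v} → v ∈ select P (allVecs k) → P v ≡ true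
  in-P v∈ = proj₂ (∈-filter⁻ (λ x → P x ≟ true) {xs = allVecs k} v∈)
  injective-on-P : ∀ {u v} → u ∈ select P (allVecs k) → v ∈ select P (allVecs k) → g u ≡ g v → u ≡ v
  injective-on-P u∈ v∈ = injective _ _ (in-P u∈) (in-P v∈)
  image⊆R : ∀ {y} → y ∈ map g (select P (allVecs k)) → y ∈ select R (allVecs n)
  image⊆R y∈ with ∈-map⁻ g y∈
  ... | v , v∈ , refl = ∈-filter⁺ (λ x → R x ≟ true) (allVecs-complete (g v)) (maps-into v (in-P v∈))

embedding-bound : ∀ {k n} (g : V k → V n) → (∀ u v → g u ≡ g v → u ≡ v) → 2 ^ k ≤ 2 ^ n
embedding-bound {k} {n} g injective = begin
  2 ^ k                        ≡⟨ sym (trans (count-true (allVecs k)) (allVecs-length k)) ⟩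
  card {k} (λ _ → true)        ≤⟨ card-injection (λ _ → true) (λ _ → true) g (λ _ _ → refl) (λ u v _ _ → injective u v) ⟩
  card {n} (λ _ → true)        ≡⟨ trans (count-true (allVecs n)) (allVecs-length n) ⟩
  2 ^ n                        ∎
  where open ≤-Reasoning

card-split : ∀ {n} (P R : Subset n) → R ⊆ P → card (λ v → P v ∧ not (R v)) + card R ≡ card P
card-split {n} P R R⊆P = count-split P R (allVecs n) R⊆P

combo-closed : ∀ {n k} (H : Subset n) → IsSubspace H → (b : Vec (V n) k) →
  VecAll (λ x → H x ≡ true) b → ∀ c → H (combo c b) ≡ true
combo-closed H (𝟎∈H , closed) [] [] [] = 𝟎∈H
combo-closed H (𝟎∈H , closed) (_ ∷ b) (_ ∷ b⊆H) (false ∷ c) = closed 𝟎 _ 𝟎∈H (combo-closed H (𝟎∈H , closed) b b⊆H c)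
combo-closed H (𝟎∈H , closed) (x ∷ b) (x∈H ∷ b⊆H) (true ∷ c) = closed x _ x∈H (combo-closed H (𝟎∈H , closed) b b⊆H c)

scale-xor : ∀ {n} (p q : Bool) (x : V n) → (if p xor q then x else 𝟎) ≡ (if p then x else 𝟎) ⊕ (if q then x else 𝟎)
scale-xor false false x = sym (⊕-identityʳ 𝟎)
scale-xor false true  x = sym (⊕-identityˡ x)
scale-xor true  false x = sym (⊕-identityʳ x)
scale-xor true  true  x = sym (⊕-self x)

combo-⊕ : ∀ {n k} (c c' : Vec Bool k) (b : Vec (V n) k) → combo (c ⊕ c') b ≡ combo c b ⊕ combo c' b
combo-⊕ [] [] [] = sym (⊕-identityʳ 𝟎)
combo-⊕ (p ∷ c) (q ∷ c') (x ∷ b) =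
  trans (cong₂ _⊕_ (scale-xor p q x) (combo-⊕ c c' b))
        (⊕-interchange (if p then x else 𝟎) (if q then x else 𝟎) (combo c b) (combo c' b))

independent⇒injective : ∀ {n k} (b : Vec (V n) k) → LinIndep b → ∀ c c' → combo c b ≡ combo c' b → c ≡ c'
independent⇒injective b independent c c' e =
  ⊕≡𝟎⇒≡ c c' (independent (c ⊕ c') (trans (combo-⊕ c c' b) (trans (cong (_⊕ combo c' b) e) (⊕-self (combo c' b)))))

extend-independent : ∀ {n k} (H : Subset n) (b : Vec (V n) k) → LinIndep b →
  (∀ c → H (combo c b) ≡ true) → ∀ u u' → H u ≡ false → H u' ≡ false → H (u ⊕ u') ≡ false →
  LinIndep (u ∷ u' ∷ b)
extend-independent H b independent span⊆H u u' u∉H u'∉H uu'∉H = go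
  where
  outside-span : ∀ {x} c → H x ≡ false → x ⊕ combo c b ≡ 𝟎 → ⊥
  outside-span c x∉H e = true≢false (subst (λ z → H z ≡ true) (sym (⊕≡𝟎⇒≡ _ _ e)) (span⊆H c)) x∉H
  go : LinIndep (u ∷ u' ∷ b)
  go (false ∷ false ∷ c) e = cong (λ c → false ∷ false ∷ c) (independent c (trans (sym (⊕-identityˡ _)) (trans (sym (⊕-identityˡ _)) e)))
  go (true  ∷ false ∷ c) e = ⊥-elim (outside-span c u∉H (trans (cong (u ⊕_) (sym (⊕-identityˡ _))) e))
  go (false ∷ true  ∷ c) e = ⊥-elim (outside-span c u'∉H (trans (sym (⊕-identityˡ _)) e))
  go (true  ∷ true  ∷ c) e = ⊥-elim (outside-span c uu'∉H (trans (⊕-assoc u u' _) e))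

-- A hyperplane contains the sum of any two vectors outside it: otherwise the two vectors
-- would extend a basis of H to m + 2 independent vectors in 𝔽₂^(m+1).
codim1-sum : ∀ {n} (H : Subset n) → Codim1 H → ∀ u u' → H u ≡ false → H u' ≡ false → H (u ⊕ u') ≡ true
codim1-sum H (m , refl , H-subspace , b , b⊆H , independent , _) u u' u∉H u'∉H with H (u ⊕ u') in uu'-test
... | true = refl
... | false = ⊥-elim (<⇒≱ (^-monoʳ-< 2 (s≤s (s≤s z≤n)) (n<1+n (suc m))) (embedding-bound coordinates injective))
  where
  coordinates : V (suc (suc m)) → V (suc m)
  coordinates c = combo c (u ∷ u' ∷ b)
  injective : ∀ c c' → coordinates c ≡ coordinates c' → c ≡ c'
  injective = independent⇒injective (u ∷ u' ∷ b)
    (extend-independent H b independent (combo-closed H H-subspace b b⊆H) u u' u∉H u'∉H uu'-test)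

outside-shift : ∀ {n} (H : Subset n) → IsSubspace H → ∀ {z y} → H z ≡ false → H y ≡ true → H (z ⊕ y) ≡ false
outside-shift H (_ , closed) {z} {y} z∉H y∈H with H (z ⊕ y) in zy∈H
... | false = refl
... | true = ⊥-elim (true≢false (subst (λ x → H x ≡ true) back (closed (z ⊕ y) y zy∈H y∈H)) z∉H)
  where
  back : (z ⊕ y) ⊕ y ≡ z
  back = trans (⊕-assoc z y y) (trans (cong (z ⊕_) (⊕-self y)) (⊕-identityʳ z))

module _ {A : Set} where

  first : A → (A → Bool) → List A → A
  first d p = foldr (λ x r → if p x then x else r) d

  first-dichotomy : (d : A) (p : A → Bool) (xs : List A) →
    p (first d p xs) ≡ true ⊎ (∀ {x} → x ∈ xs → p x ≡ false)
  first-dichotomy d p [] = inj₂ (λ ())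
  first-dichotomy d p (x ∷ xs) with p x in px
  ... | true = inj₁ px
  ... | false with first-dichotomy d p xs
  ...   | inj₁ found = inj₁ found
  ...   | inj₂ none = inj₂ λ { (here refl) → px ; (there y∈xs) → none y∈xs }

  first-succeeds : (d : A) (p : A → Bool) {xs : List A} {x : A} → x ∈ xs → p x ≡ true → p (first d p xs) ≡ true
  first-succeeds d p {xs} x∈xs px with first-dichotomy d p xs
  ... | inj₁ found = found
  ... | inj₂ none = ⊥-elim (true≢false px (none x∈xs))

  first-cong : (d : A) {p q : A → Bool} → (∀ x → p x ≡ q x) → (xs : List A) → first d p xs ≡ first d q xs
  first-cong d p≗q [] = refl
  first-cong d p≗q (x ∷ xs) =
    cong₂ (λ b r → if b then x else r) (p≗q x) (first-cong d p≗q xs)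

  allᵇ : (A → Bool) → List A → Bool
  allᵇ p = foldr (λ x acc → p x ∧ acc) true

  allᵇ-sound : (p : A → Bool) (xs : List A) → allᵇ p xs ≡ true → ∀ {x} → x ∈ xs → p x ≡ true
  allᵇ-sound p (y ∷ ys) holds (here refl) = proj₁ (∧-true⁻ holds)
  allᵇ-sound p (y ∷ ys) holds (there x∈ys) = allᵇ-sound p ys (proj₂ (∧-true⁻ holds)) x∈ys

  allᵇ-intro : (p : A → Bool) (xs : List A) → (∀ x → p x ≡ true) → allᵇ p xs ≡ true
  allᵇ-intro p [] all-p = refl
  allᵇ-intro p (x ∷ xs) all-p = cong₂ _∧_ (all-p x) (allᵇ-intro p xs all-p)

  allᵇ-cong : {p q : A → Bool} → (∀ x → p x ≡ q x) → (xs : List A) → allᵇ p xs ≡ allᵇ q xs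
  allᵇ-cong p≗q [] = refl
  allᵇ-cong p≗q (x ∷ xs) = cong₂ _∧_ (p≗q x) (allᵇ-cong p≗q xs)

perp-sound : ∀ {n} (a : Coeffs n) (T : Subset n) {v t : V n} → perp a T v ≡ true → T t ≡ true → B a v t ≡ false
perp-sound {n} a T {v} {t} v∈T⊥ t∈T =
  not-true⁻ (subst (λ b → not b ∨ not (B a v t) ≡ true) t∈T
    (allᵇ-sound (λ t → not (T t) ∨ not (B a v t)) (allVecs n) v∈T⊥ (allVecs-complete t)))

perp-intro : ∀ {n} (a : Coeffs n) (T : Subset n) (v : V n) → (∀ t → T t ≡ true → B a v t ≡ false) → perp a T v ≡ true
perp-intro {n} a T v v⊥T = allᵇ-intro (λ t → not (T t) ∨ not (B a v t)) (allVecs n) term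
  where
  term : ∀ t → not (T t) ∨ not (B a v t) ≡ true
  term t with T t in t∈T
  ... | false = refl
  ... | true = cong not (v⊥T t t∈T)

perp-cong : ∀ {n} (a : Coeffs n) (T : Subset n) {v v' : V n} →
  (∀ {t} → T t ≡ true → B a v t ≡ B a v' t) → perp a T v ≡ perp a T v'
perp-cong {n} a T {v} {v'} same = allᵇ-cong term (allVecs n)
  where
  term : ∀ t → not (T t) ∨ not (B a v t) ≡ not (T t) ∨ not (B a v' t)
  term t with T t in t∈T
  ... | false = refl
  ... | true = cong not (same t∈T)

module Injection {n} (a : Coeffs n) (H : Subset n) (anis : RadAnisotropic a) (cd : Codim1 H)
                 (gen : Generates (Sset a H)) (T : Subset n) (T⊆S : T ⊆ Sset a H) where

  S U S∖T : Subset n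
  S = Sset a H
  U = perp a T ∩ T
  S∖T v = S v ∧ not (T v)

  H-subspace : IsSubspace H
  H-subspace = proj₁ (proj₂ (proj₂ cd))

  S-singular : ∀ {v} → S v ≡ true → Q a v ≡ false
  S-singular v∈S = not-true⁻ (proj₁ (∧-true⁻ v∈S))

  S-outside : ∀ {v} → S v ≡ true → H v ≡ false
  S-outside v∈S = not-true⁻ (proj₂ (∧-true⁻ v∈S))

  U⊆S : ∀ {w} → U w ≡ true → S w ≡ true
  U⊆S {w} w∈U = T⊆S w (proj₂ (∧-true⁻ w∈U))

  U⊥T : ∀ {w t} → U w ≡ true → T t ≡ true → B a w t ≡ false
  U⊥T {w} w∈U = perp-sound a T {w} (proj₁ (∧-true⁻ {perp a T w} w∈U))

  U-isotropic : ∀ {w w'} → U w ≡ true → U w' ≡ true → B a w w' ≡ false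
  U-isotropic w∈U w'∈U = U⊥T w∈U (proj₂ (∧-true⁻ w'∈U))

  partner : V n → V n
  partner u = first 𝟎 (λ s → S s ∧ B a u s) (allVecs n)

  -- Every u ∈ S has a partner: otherwise u ⊥ S, so u = 𝟎 ∈ H, contradicting u ∉ H.
  partner-spec : ∀ {u} → S u ≡ true → S (partner u) ≡ true × B a u (partner u) ≡ true
  partner-spec {u} u∈S with first-dichotomy 𝟎 (λ s → S s ∧ B a u s) (allVecs n)
  ... | inj₁ found = ∧-true⁻ found
  ... | inj₂ none = ⊥-elim (true≢false (subst (λ x → H x ≡ true) (sym u≡𝟎) (proj₁ H-subspace)) (S-outside u∈S))
    where
    u⊥S : ∀ s → S s ≡ true → B a u s ≡ false
    u⊥S s s∈S = subst (λ b → b ∧ B a u s ≡ false) s∈S (none (allVecs-complete s))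
    u≡𝟎 : u ≡ 𝟎
    u≡𝟎 = orthogonal-to-generators a S anis gen u (S-singular u∈S) u⊥S

  rep : V n → V n
  rep u = first 𝟎 (λ x → S x ∧ perp a U (partner u ⊕ x)) (allVecs n)

  mateOf : V n → V n
  mateOf x = first 𝟎 (λ w → U w ∧ B a x w) (allVecs n)

  g : V n → V n
  g u = rep u ⊕ (u ⊕ mateOf (rep u))

  module Image {u} (u∈U : U u ≡ true) where

    x m : V n
    x = rep u
    m = mateOf x

    -- partner u lies in its own coset, so the search for x(u) succeeds.
    rep-spec : S x ≡ true × perp a U (partner u ⊕ x) ≡ true
    rep-spec = ∧-true⁻ (first-succeeds 𝟎 (λ y → S y ∧ perp a U (partner u ⊕ y)) (allVecs-complete (partner u))
                 (cong₂ _∧_ (proj₁ (partner-spec (U⊆S u∈U))) own-coset))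
      where
      own-coset : perp a U (partner u ⊕ partner u) ≡ true
      own-coset = subst (λ z → perp a U z ≡ true) (sym (⊕-self (partner u))) (perp-intro a U 𝟎 (λ t _ → B-zeroˡ a t))

    x∈S : S x ≡ true
    x∈S = proj₁ rep-spec

    x-functional : ∀ {w} → U w ≡ true → B a x w ≡ B a (partner u) w
    x-functional {w} w∈U =
      sym (xor-false⁻ (trans (sym (B-linearˡ a (partner u) x w)) (perp-sound a U {partner u ⊕ x} (proj₂ rep-spec) w∈U)))

    x-pairs-u : B a x u ≡ true
    x-pairs-u = trans (x-functional u∈U) (trans (B-sym a (partner u) u) (proj₂ (partner-spec (U⊆S u∈U))))

    -- u itself passes the test defining m, so the search for m succeeds.
    mate-spec : U m ≡ true × B a x m ≡ true
    mate-spec = ∧-true⁻ (first-succeeds 𝟎 (λ w → U w ∧ B a x w) (allVecs-complete u) (cong₂ _∧_ u∈U x-pairs-u))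

    m∈U : U m ≡ true
    m∈U = proj₁ mate-spec

    -- Q(x + u + m) = B(x,u) + B(x,m) + B(u,m) + Q(x) + Q(u) + Q(m) = 1 + 1 + 0 + 0 + 0 + 0.
    g-singular : Q a (x ⊕ (u ⊕ m)) ≡ false
    g-singular = begin
      Q a (x ⊕ (u ⊕ m))
        ≡⟨ Q-⊕ a x (u ⊕ m) ⟩
      B a x (u ⊕ m) xor (Q a x xor Q a (u ⊕ m))
        ≡⟨ cong₂ (λ b q → b xor (Q a x xor q)) (B-linearʳ a x u m) (Q-⊕ a u m) ⟩
      (B a x u xor B a x m) xor (Q a x xor (B a u m xor (Q a u xor Q a m)))
        ≡⟨ cong₂ (λ b q → b xor q) (cong₂ _xor_ x-pairs-u (proj₂ mate-spec))
                 (cong₂ _xor_ (S-singular x∈S) (cong₂ _xor_ (U-isotropic u∈U m∈U)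
                   (cong₂ _xor_ (S-singular (U⊆S u∈U)) (S-singular (U⊆S m∈U))))) ⟩
      (true xor true) xor (false xor (false xor (false xor false)))
        ≡⟨⟩
      false ∎
      where open ≡-Reasoning

    -- u, m ∉ H, so u + m ∈ H, while x ∉ H.
    g∉H : H (x ⊕ (u ⊕ m)) ≡ false
    g∉H = outside-shift H H-subspace (S-outside x∈S)
            (codim1-sum H cd u m (S-outside (U⊆S u∈U)) (S-outside (U⊆S m∈U)))

    -- On U, g(u) induces the same functional as x(u), since u, m ∈ U and U is isotropic.
    g-functional : ∀ {w} → U w ≡ true → B a (x ⊕ (u ⊕ m)) w ≡ B a x w
    g-functional {w} w∈U = begin
      B a (x ⊕ (u ⊕ m)) w                ≡⟨ B-linearˡ a x (u ⊕ m) w ⟩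
      B a x w xor B a (u ⊕ m) w          ≡⟨ cong (B a x w xor_) (B-linearˡ a u m w) ⟩
      B a x w xor (B a u w xor B a m w)  ≡⟨ cong (B a x w xor_) (cong₂ _xor_ (U-isotropic u∈U w∈U) (U-isotropic m∈U w∈U)) ⟩
      B a x w xor false                  ≡⟨ xor-identityʳ (B a x w) ⟩
      B a x w                            ∎
      where open ≡-Reasoning

    -- B(u, g(u)) = B(x(u), u) = 1, whereas u is orthogonal to T.
    g∉T : T (g u) ≡ false
    g∉T with T (g u) in g∈T
    ... | false = refl
    ... | true = ⊥-elim (true≢false (trans (B-sym a u (g u)) (trans (g-functional u∈U) x-pairs-u)) (U⊥T u∈U g∈T))

    g∈S∖T : S∖T (g u) ≡ true
    g∈S∖T = cong₂ (λ s t → s ∧ not t) (cong₂ (λ q h → not q ∧ not h) g-singular g∉H) g∉T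

  -- g(u) = g(v) forces x(u) = x(v), then m(x(u)) = m(x(v)), and finally u = v.
  g-injective : ∀ u v → U u ≡ true → U v ≡ true → g u ≡ g v → u ≡ v
  g-injective u v u∈U v∈U gu≡gv =
    ⊕-cancelʳ (mateOf (rep v)) (⊕-cancelˡ (rep v) (subst (λ x → x ⊕ (u ⊕ mateOf x) ≡ g v) same-rep gu≡gv))
    where
    module Iu = Image u∈U
    module Iv = Image v∈U

    same-class : ∀ {w} → U w ≡ true → B a (partner u) w ≡ B a (partner v) w
    same-class {w} w∈U = begin
      B a (partner u) w  ≡⟨ sym (Iu.x-functional w∈U) ⟩
      B a (rep u) w      ≡⟨ sym (Iu.g-functional w∈U) ⟩
      B a (g u) w        ≡⟨ cong (λ z → B a z w) gu≡gv ⟩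
      B a (g v) w        ≡⟨ Iv.g-functional w∈U ⟩
      B a (rep v) w      ≡⟨ Iv.x-functional w∈U ⟩
      B a (partner v) w  ∎
      where open ≡-Reasoning

    same-coset : ∀ y → perp a U (partner u ⊕ y) ≡ perp a U (partner v ⊕ y)
    same-coset y = perp-cong a U {partner u ⊕ y} {partner v ⊕ y} λ {w} w∈U → begin
      B a (partner u ⊕ y) w          ≡⟨ B-linearˡ a (partner u) y w ⟩
      B a (partner u) w xor B a y w  ≡⟨ cong (_xor B a y w) (same-class w∈U) ⟩
      B a (partner v) w xor B a y w  ≡⟨ sym (B-linearˡ a (partner v) y w) ⟩
      B a (partner v ⊕ y) w          ∎
      where open ≡-Reasoning

    same-rep : rep u ≡ rep v
    same-rep = first-cong 𝟎 (λ y → cong (S y ∧_) (same-coset y)) (allVecs n)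

lemma3p3 : (n : ℕ) (a : Coeffs n) (H : Subset n) →
    RadAnisotropic a → Codim1 H → Generates (Sset a H) →
    (T : Subset n) → T ⊆ Sset a H →
    card (perp a T ∩ T) ≤ card (Sset a H) ∸ card T
lemma3p3 n a H anis cd gen T T⊆S = m+n≤o⇒m≤o∸n (card U) (begin
  card U + card T    ≤⟨ +-monoˡ-≤ (card T) (card-injection U S∖T g (λ u u∈U → Image.g∈S∖T u∈U) g-injective) ⟩
  card S∖T + card T  ≡⟨ card-split S T T⊆S ⟩
  card S             ∎)
  where
  open Injection a H anis cd gen T T⊆S
  open ≤-Reasoning
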